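{- Let $G$ be a finite bipartite graph with bipartition $\{A,B\}$, where every vertex in $A$ has degree at most $d$ and every vertex in $B$ has degree at most $\Delta$. Let $r,t,\ell$ be positive integers such that \[ \ell \geq e \left(\frac{ed}{r+1}\right)^{1+1/r} \quad\text{and}\quad t\geq\log( 4 d \Delta). \] Then there exist $t$ maps $c_1,\dots,c_t: B\to[\ell]$ (colourings, not necessarily proper) such that for each vertex $v\in A$ there is some $i\in[t]$ for which each colour in $[\ell]$ is assigned by $c_i$ to at most $r$ neighbours of $v$.
   Context: $[\ell]=\{1,\dots,\ell\}$; $\log$ is the natural logarithm. -}

module Defs where

open import Data.Nat using (ℕ; zero; suc; _+_; _*_; _^_; _≡ᵇ_)
open import Data.Bool using (Bool; true; false; _∧_)
open import Data.Fin using (Fin; zero; suc; toℕ)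

b2n : Bool → ℕ
b2n true  = 1
b2n false = 0

count : ∀ {n} → (Fin n → Bool) → ℕ
count {zero}  p = 0
count {suc n} p = b2n (p zero) + count (λ i → p (suc i))

-- A finite (simple) bipartite graph with parts A = Fin a, B = Fin b is given
-- by its adjacency relation E : Fin a → Fin b → Bool.
degA : ∀ {a b} → (Fin a → Fin b → Bool) → Fin a → ℕ
degA E v = count (λ w → E v w)

degB : ∀ {a b} → (Fin a → Fin b → Bool) → Fin b → ℕ
degB E w = count (λ v → E v w)

-- expNum k n = n! * Σ_{j=0}^{n} k^j / j!   (a natural number);
-- so expNum k n / n! is the n-th partial sum of the series of e^k.
expNum : ℕ → ℕ → ℕ
expNum k zero    = 1
expNum k (suc n) = suc n * expNum k n + k ^ suc n

colourCount : ∀ {a b ℓ} → (Fin a → Fin b → Bool) → (Fin b → Fin ℓ) → Fin a → Fin ℓ → ℕ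
colourCount E c v k = count (λ w → E v w ∧ (toℕ (c w) ≡ᵇ toℕ k))

module Submission where

-- Colour B uniformly at random t times, independently.  For a single colouring and v ∈ A, some colour
-- is used on more than r of the at most d neighbours of v with probability at most
-- ℓ · d^(r+1) / (ℓ^(r+1) (r+1)!), which the first hypothesis (at n = r+2) makes at most 1/4.  So the
-- event that all t colourings fail at v has probability at most 4^(-t) ≤ 1 / (4 max(dΔ, 1)), using the
-- second hypothesis and that the partial sums of e^t are at most 4^t (they are submultiplicative).
-- This event is determined by the colours of the neighbours of v, hence independent of the events of
-- all but the at most dΔ vertices sharing a neighbour with v, and the symmetric local lemma, proved by
-- counting over the uniform space [ℓ]^(t·b), gives colourings avoiding all of them.

open import Defs
open import Data.Nat using (ℕ; zero; suc; _+_; _*_; _^_; _∸_; _≤_; _<_; z≤n; s≤s; _!; _≡ᵇ_; _<ᵇ_; _⊔_; >-nonZero)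
open import Data.Nat.Properties hiding (suc-injective; 0≢1+n)
open import Data.Nat.Tactic.RingSolver using (solve-∀)
open import Data.Bool using (Bool; true; false; _∧_; _∨_; not)
open import Data.Bool.Properties using (T-≡)
open import Function.Bundles using (Equivalence)
open import Data.Fin using (Fin; zero; suc; toℕ; fromℕ<; _↑ˡ_; _↑ʳ_; combine; remQuot)
open import Data.Fin.Properties using (suc-injective; 0≢1+n; toℕ-injective; toℕ-fromℕ<; toℕ<n; remQuot-combine)
open import Data.Vec.Functional using ([]; _∷_)
open import Data.Product using (Σ; ∃-syntax; _×_; _,_; proj₁; proj₂)
open import Data.Empty using (⊥; ⊥-elim)
open import Data.Sum using (inj₁; inj₂)
open import Function using (_∘_)
open import Relation.Binary.PropositionalEquality
open import Algebra.Properties.CommutativeSemigroup *-commutativeSemigroup using (x∙yz≈y∙xz; xy∙z≈xz∙y; x∙yz≈yx∙z)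
open import Algebra.Properties.Semiring.Sum +-*-semiring
  using (sum; sum-syntax; sum-cong-≗; ∑-distrib-+; ∑-comm; *-distribˡ-sum; *-distribʳ-sum)

sum-mono-≤ : ∀ {m} {f g : Fin m → ℕ} → (∀ i → f i ≤ g i) → sum f ≤ sum g
sum-mono-≤ {zero}  f≤g = z≤n
sum-mono-≤ {suc m} f≤g = +-mono-≤ (f≤g zero) (sum-mono-≤ (f≤g ∘ suc))

sum-const : ∀ m c → ∑[ i < m ] c ≡ m * c
sum-const zero    c = refl
sum-const (suc m) c = cong (c +_) (sum-const m c)

term≤sum : ∀ {m} (f : Fin m → ℕ) i → f i ≤ sum f
term≤sum f zero    = m≤m+n (f zero) _
term≤sum f (suc i) = ≤-trans (term≤sum (f ∘ suc) i) (m≤n+m _ (f zero))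

sum-pos⇒term-pos : ∀ {m} (f : Fin m → ℕ) → 1 ≤ sum f → ∃[ i ] 1 ≤ f i
sum-pos⇒term-pos {suc m} f pos with f zero in eq
... | suc _ = zero , subst (1 ≤_) (sym eq) (s≤s z≤n)
... | zero  with sum-pos⇒term-pos (f ∘ suc) pos
...   | i , fi-pos = suc i , fi-pos

sum-supported-at : ∀ {m} (f : Fin m → ℕ) i → (∀ j → j ≢ i → f j ≡ 0) → sum f ≡ f i
sum-supported-at {suc m} f zero vanish = begin
  f zero + sum (f ∘ suc)          ≡⟨ cong (f zero +_) (sum-cong-≗ (λ j → vanish (suc j) λ ())) ⟩
  f zero + ∑[ j < m ] 0           ≡⟨ cong (f zero +_) (trans (sum-const m 0) (*-zeroʳ m)) ⟩
  f zero + 0                      ≡⟨ +-identityʳ (f zero) ⟩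
  f zero                          ∎
  where open ≡-Reasoning
sum-supported-at {suc m} f (suc i) vanish =
  trans (cong (_+ sum (f ∘ suc)) (vanish zero λ ()))
        (sum-supported-at (f ∘ suc) i λ j j≢i → vanish (suc j) (j≢i ∘ suc-injective))

sum-++ : ∀ m n (f : Fin (m + n) → ℕ) → sum f ≡ sum (λ i → f (i ↑ˡ n)) + sum (λ j → f (m ↑ʳ j))
sum-++ zero    n f = refl
sum-++ (suc m) n f = trans (cong (f zero +_) (sum-++ m n (f ∘ suc))) (sym (+-assoc (f zero) _ _))

sum-combine : ∀ t b (f : Fin (t * b) → ℕ) → sum f ≡ ∑[ i < t ] ∑[ w < b ] f (combine i w)
sum-combine zero    b f = refl
sum-combine (suc t) b f =
  trans (sum-++ b (t * b) f) (cong (sum (λ w → f (w ↑ˡ t * b)) +_) (sum-combine t b (f ∘ (b ↑ʳ_))))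

sum-*-constant : ∀ m (a c : Fin m → ℕ) → (∀ x y → a x ≡ a y) →
  m * ∑[ x < m ] (a x * c x) ≡ sum a * sum c
sum-*-constant zero    a c a-const = refl
sum-*-constant (suc m) a c a-const = begin
  suc m * ∑[ x < suc m ] (a x * c x) ≡⟨ cong (suc m *_) (sum-cong-≗ λ x → cong (_* c x) (a-const x zero)) ⟩
  suc m * ∑[ x < suc m ] (a₀ * c x)  ≡⟨ cong (suc m *_) (sym (*-distribˡ-sum a₀ c)) ⟩
  suc m * (a₀ * sum c)               ≡⟨ sym (*-assoc (suc m) a₀ (sum c)) ⟩
  suc m * a₀ * sum c                 ≡⟨ cong (_* sum c) (sym (trans (sum-cong-≗ λ x → a-const x zero) (sum-const (suc m) a₀))) ⟩
  sum a * sum c                      ∎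
  where
  open ≡-Reasoning
  a₀ = a zero

b2n≤1 : ∀ x → b2n x ≤ 1
b2n≤1 true  = ≤-refl
b2n≤1 false = z≤n

b2n-∧ : ∀ x y → b2n (x ∧ y) ≡ b2n x * b2n y
b2n-∧ true  y = sym (+-identityʳ _)
b2n-∧ false y = refl

b2n-mono : ∀ {x y} → (x ≡ true → y ≡ true) → b2n x ≤ b2n y
b2n-mono {false}         _   = z≤n
b2n-mono {true}  {true}  _   = ≤-refl
b2n-mono {true}  {false} x⇒y with x⇒y refl
... | ()

count≡sum : ∀ {m} (p : Fin m → Bool) → count p ≡ ∑[ i < m ] b2n (p i)
count≡sum {zero}  p = refl
count≡sum {suc m} p = cong (b2n (p zero) +_) (count≡sum (p ∘ suc))

count-cong : ∀ {m} {p q : Fin m → Bool} → (∀ i → p i ≡ q i) → count p ≡ count q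
count-cong {p = p} {q} p≗q = trans (count≡sum p) (trans (sum-cong-≗ (cong b2n ∘ p≗q)) (sym (count≡sum q)))

count-mono : ∀ {m} (p q : Fin m → Bool) → (∀ i → p i ≡ true → q i ≡ true) → count p ≤ count q
count-mono p q p⇒q = subst₂ _≤_ (sym (count≡sum p)) (sym (count≡sum q)) (sum-mono-≤ (b2n-mono ∘ p⇒q))

count-pos : ∀ {m} (p : Fin m → Bool) i → p i ≡ true → 1 ≤ count p
count-pos p i pi = subst (1 ≤_) (sym (count≡sum p))
  (≤-trans (≤-reflexive (cong b2n (sym pi))) (term≤sum (b2n ∘ p) i))

count-false : ∀ m → count {m} (λ _ → false) ≡ 0
count-false zero    = refl
count-false (suc m) = count-false m

∧-true : ∀ {x y} → x ∧ y ≡ true → x ≡ true × y ≡ true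
∧-true {true} {true} _ = refl , refl

not-true : ∀ {x} → not x ≡ true → x ≡ false
not-true {false} _ = refl

allᵇ : ∀ {m} → (Fin m → Bool) → Bool
allᵇ {zero}  p = true
allᵇ {suc m} p = p zero ∧ allᵇ (p ∘ suc)

anyᵇ : ∀ {m} → (Fin m → Bool) → Bool
anyᵇ {zero}  p = false
anyᵇ {suc m} p = p zero ∨ anyᵇ (p ∘ suc)

allᵇ-elim : ∀ {m} (p : Fin m → Bool) → allᵇ p ≡ true → ∀ i → p i ≡ true
allᵇ-elim p all-p zero    with p zero | all-p
... | true | _ = refl
allᵇ-elim p all-p (suc i) with p zero | all-p
... | true | all-p′ = allᵇ-elim (p ∘ suc) all-p′ i

allᵇ-intro : ∀ {m} (p : Fin m → Bool) → (∀ i → p i ≡ true) → allᵇ p ≡ true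
allᵇ-intro {zero}  p every = refl
allᵇ-intro {suc m} p every rewrite every zero = allᵇ-intro (p ∘ suc) (every ∘ suc)

allᵇ-false : ∀ {m} (p : Fin m → Bool) → allᵇ p ≡ false → ∃[ i ] p i ≡ false
allᵇ-false {suc m} p not-all with p zero in p₀
... | false = zero , p₀
... | true  with allᵇ-false (p ∘ suc) not-all
...   | i , pi = suc i , pi

allᵇ-cong : ∀ {m} {p q : Fin m → Bool} → (∀ i → p i ≡ q i) → allᵇ p ≡ allᵇ q
allᵇ-cong {zero}  p≗q = refl
allᵇ-cong {suc m} p≗q = cong₂ _∧_ (p≗q zero) (allᵇ-cong (p≗q ∘ suc))

anyᵇ-intro : ∀ {m} (p : Fin m → Bool) i → p i ≡ true → anyᵇ p ≡ true
anyᵇ-intro p zero pi rewrite pi = refl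
anyᵇ-intro p (suc i) pi with p zero
... | true  = refl
... | false = anyᵇ-intro (p ∘ suc) i pi

anyᵇ-elim : ∀ {m} (p : Fin m → Bool) → anyᵇ p ≡ true → ∃[ i ] p i ≡ true
anyᵇ-elim {suc m} p any-p with p zero in p₀
... | true  = zero , p₀
... | false with anyᵇ-elim (p ∘ suc) any-p
...   | i , pi = suc i , pi

anyᵇ-false : ∀ {m} (p : Fin m → Bool) → anyᵇ p ≡ false → ∀ i → p i ≡ false
anyᵇ-false p none i with p i in pi
... | false = refl
... | true  with trans (sym (anyᵇ-intro p i pi)) none
...   | ()

anyᵇ-cong : ∀ {m} {p q : Fin m → Bool} → (∀ i → p i ≡ q i) → anyᵇ p ≡ anyᵇ q
anyᵇ-cong {zero}  p≗q = refl
anyᵇ-cong {suc m} p≗q = cong₂ _∨_ (p≗q zero) (anyᵇ-cong (p≗q ∘ suc))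

b2n-anyᵇ≤sum : ∀ {m} (p : Fin m → Bool) → b2n (anyᵇ p) ≤ ∑[ i < m ] b2n (p i)
b2n-anyᵇ≤sum {zero}  p = z≤n
b2n-anyᵇ≤sum {suc m} p with p zero
... | true  = s≤s z≤n
... | false = b2n-anyᵇ≤sum (p ∘ suc)

*-cancelʳ-≤-pos : ∀ m n o → 0 < o → m * o ≤ n * o → m ≤ n
*-cancelʳ-≤-pos m n o o>0 = *-cancelʳ-≤ m n o {{>-nonZero o>0}}

^-pos : ∀ m k → 0 < m → 0 < m ^ k
^-pos m k m>0 = m^n>0 m {{>-nonZero m>0}} k

module Outcomes (ℓ : ℕ) where

  Ω : ℕ → Set
  Ω n = Fin n → Fin ℓ

  ∑Ω : ∀ n → (Ω n → ℕ) → ℕ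
  ∑Ω zero    h = h []
  ∑Ω (suc n) h = ∑[ x < ℓ ] ∑Ω n (λ g → h (x ∷ g))

  card : ∀ n → (Ω n → Bool) → ℕ
  card n P = ∑Ω n (b2n ∘ P)

  ∑Ω-cong : ∀ n {h h′ : Ω n → ℕ} → (∀ f → h f ≡ h′ f) → ∑Ω n h ≡ ∑Ω n h′
  ∑Ω-cong zero    h≗h′ = h≗h′ []
  ∑Ω-cong (suc n) h≗h′ = sum-cong-≗ λ x → ∑Ω-cong n (λ g → h≗h′ (x ∷ g))

  ∑Ω-mono-≤ : ∀ n {h h′ : Ω n → ℕ} → (∀ f → h f ≤ h′ f) → ∑Ω n h ≤ ∑Ω n h′
  ∑Ω-mono-≤ zero    h≤h′ = h≤h′ []
  ∑Ω-mono-≤ (suc n) h≤h′ = sum-mono-≤ λ x → ∑Ω-mono-≤ n (λ g → h≤h′ (x ∷ g))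

  ∑Ω-distrib-+ : ∀ n (h h′ : Ω n → ℕ) → ∑Ω n (λ f → h f + h′ f) ≡ ∑Ω n h + ∑Ω n h′
  ∑Ω-distrib-+ zero    h h′ = refl
  ∑Ω-distrib-+ (suc n) h h′ =
    trans (sum-cong-≗ λ x → ∑Ω-distrib-+ n (h ∘ (x ∷_)) (h′ ∘ (x ∷_))) (∑-distrib-+ {ℓ} _ _)

  *-distribˡ-∑Ω : ∀ n c (h : Ω n → ℕ) → ∑Ω n (λ f → c * h f) ≡ c * ∑Ω n h
  *-distribˡ-∑Ω zero    c h = refl
  *-distribˡ-∑Ω (suc n) c h =
    trans (sum-cong-≗ λ x → *-distribˡ-∑Ω n c (h ∘ (x ∷_))) (sym (*-distribˡ-sum {ℓ} c _))

  ∑Ω-const : ∀ n c → ∑Ω n (λ _ → c) ≡ ℓ ^ n * c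
  ∑Ω-const zero    c = sym (+-identityʳ c)
  ∑Ω-const (suc n) c = trans (sum-cong-≗ {ℓ} λ _ → ∑Ω-const n c)
                             (trans (sum-const ℓ (ℓ ^ n * c)) (sym (*-assoc ℓ (ℓ ^ n) c)))

  ∑Ω-comm : ∀ n m (h : Fin m → Ω n → ℕ) → ∑Ω n (λ f → ∑[ u < m ] h u f) ≡ ∑[ u < m ] ∑Ω n (h u)
  ∑Ω-comm zero    m h = refl
  ∑Ω-comm (suc n) m h =
    trans (sum-cong-≗ λ x → ∑Ω-comm n m (λ u g → h u (x ∷ g))) (∑-comm {ℓ} {m} _)

  ∑Ω-pos⇒term-pos : ∀ n (h : Ω n → ℕ) → 1 ≤ ∑Ω n h → ∃[ f ] 1 ≤ h f
  ∑Ω-pos⇒term-pos zero    h pos = [] , pos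
  ∑Ω-pos⇒term-pos (suc n) h pos with sum-pos⇒term-pos {ℓ} _ pos
  ... | x , pos′ with ∑Ω-pos⇒term-pos n (h ∘ (x ∷_)) pos′
  ...   | g , hg-pos = x ∷ g , hg-pos

  card-true : ∀ n → card n (λ _ → true) ≡ ℓ ^ n
  card-true n = trans (∑Ω-const n 1) (*-identityʳ _)

  card-cong : ∀ n {P Q : Ω n → Bool} → (∀ f → P f ≡ Q f) → card n P ≡ card n Q
  card-cong n P≗Q = ∑Ω-cong n (cong b2n ∘ P≗Q)

  card-mono : ∀ n (P Q : Ω n → Bool) → (∀ f → P f ≡ true → Q f ≡ true) → card n P ≤ card n Q
  card-mono n P Q P⇒Q = ∑Ω-mono-≤ n (b2n-mono ∘ P⇒Q)

  card-empty : ∀ n (P : Ω n → Bool) → (∀ f → P f ≡ false) → card n P ≡ 0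
  card-empty n P empty = trans (card-cong n empty) (trans (∑Ω-const n 0) (*-zeroʳ (ℓ ^ n)))

  card-pos⇒witness : ∀ n (P : Ω n → Bool) → 1 ≤ card n P → ∃[ f ] P f ≡ true
  card-pos⇒witness n P pos with ∑Ω-pos⇒term-pos n _ pos
  ... | f , Pf-pos with P f in Pf
  ...   | true = f , Pf

  card-any≤sum : ∀ n m (P : Fin m → Ω n → Bool) →
    card n (λ f → anyᵇ (λ k → P k f)) ≤ ∑[ k < m ] card n (P k)
  card-any≤sum n m P =
    ≤-trans (∑Ω-mono-≤ n (λ f → b2n-anyᵇ≤sum (λ k → P k f))) (≤-reflexive (∑Ω-comm n m (λ k → b2n ∘ P k)))

  DeterminedBy : ∀ {n} → (Fin n → Bool) → (Ω n → Bool) → Set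
  DeterminedBy {n} M P = ∀ (f g : Ω n) → (∀ j → M j ≡ true → f j ≡ g j) → P f ≡ P g

  Disjoint : ∀ {n} → (Fin n → Bool) → (Fin n → Bool) → Set
  Disjoint M M′ = ∀ j → M j ≡ true → M′ j ≡ true → ⊥

  determinedBy-∷ : ∀ {n} {M : Fin (suc n) → Bool} {P : Ω (suc n) → Bool} → DeterminedBy M P →
    ∀ x → DeterminedBy (M ∘ suc) (P ∘ (x ∷_))
  determinedBy-∷ P-det x f g f≈g = P-det (x ∷ f) (x ∷ g) λ { zero _ → refl ; (suc j) → f≈g j }

  determinedBy-head-free : ∀ {n} {M : Fin (suc n) → Bool} {P : Ω (suc n) → Bool} → DeterminedBy M P →
    M zero ≡ false → ∀ x y g → P (x ∷ g) ≡ P (y ∷ g)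
  determinedBy-head-free {M = M} P-det M₀ x y g = P-det (x ∷ g) (y ∷ g) agree
    where
    agree : ∀ j → M j ≡ true → (x ∷ g) j ≡ (y ∷ g) j
    agree zero    M₀′ with trans (sym M₀) M₀′
    ... | ()
    agree (suc j) _ = refl

  allᵇ-determinedBy : ∀ {n m} (M : Fin m → Fin n → Bool) (P : Fin m → Ω n → Bool) →
    (∀ u → DeterminedBy (M u) (P u)) → DeterminedBy (λ j → anyᵇ (λ u → M u j)) (λ f → allᵇ (λ u → P u f))
  allᵇ-determinedBy M P P-det f g f≈g =
    allᵇ-cong λ u → P-det u f g λ j Muj → f≈g j (anyᵇ-intro (λ u′ → M u′ j) u Muj)

  disjoint-anyᵇ : ∀ {n m} (M : Fin n → Bool) (M′ : Fin m → Fin n → Bool) →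
    (∀ u → Disjoint M (M′ u)) → Disjoint M (λ j → anyᵇ (λ u → M′ u j))
  disjoint-anyᵇ M M′ disj j Mj any-M′j with anyᵇ-elim _ any-M′j
  ... | u , M′uj = disj u j Mj M′uj

  card-∧-independent : ∀ n (P Q : Ω n → Bool) (M M′ : Fin n → Bool) →
    DeterminedBy M P → DeterminedBy M′ Q → Disjoint M M′ →
    card n (λ f → P f ∧ Q f) * ℓ ^ n ≡ card n P * card n Q
  card-∧-independent zero P Q M M′ _ _ _ = trans (*-identityʳ _) (b2n-∧ (P []) (Q []))
  card-∧-independent (suc n) P Q M M′ P-det Q-det disj = begin
    card (suc n) P∧Q * (ℓ * ℓ ^ n)                        ≡⟨ x∙yz≈y∙xz (card (suc n) P∧Q) ℓ (ℓ ^ n) ⟩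
    ℓ * (card (suc n) P∧Q * ℓ ^ n)                        ≡⟨ cong (ℓ *_) (*-distribʳ-sum {ℓ} (ℓ ^ n) _) ⟩
    ℓ * ∑[ x < ℓ ] (card n (P∧Q ∘ (x ∷_)) * ℓ ^ n)         ≡⟨ cong (ℓ *_) (sum-cong-≗ independent-tail) ⟩
    ℓ * ∑[ x < ℓ ] (a x * c x)                             ≡⟨ head-independent ⟩
    sum a * sum c                                          ∎
    where
    open ≡-Reasoning
    P∧Q : Ω (suc n) → Bool
    P∧Q f = P f ∧ Q f
    a c : Fin ℓ → ℕ
    a x = card n (P ∘ (x ∷_))
    c x = card n (Q ∘ (x ∷_))
    independent-tail : ∀ x → card n (P∧Q ∘ (x ∷_)) * ℓ ^ n ≡ a x * c x
    independent-tail x = card-∧-independent n _ _ (M ∘ suc) (M′ ∘ suc)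
      (determinedBy-∷ P-det x) (determinedBy-∷ Q-det x) (disj ∘ suc)
    -- the first coordinate lies outside M or outside M′, so a or c does not depend on it
    head-independent : ℓ * ∑[ x < ℓ ] (a x * c x) ≡ sum a * sum c
    head-independent with M zero in M₀ | M′ zero in M′₀
    ... | true  | true  = ⊥-elim (disj zero M₀ M′₀)
    ... | false | _     = sum-*-constant ℓ a c λ x y → card-cong n (determinedBy-head-free P-det M₀ x y)
    ... | true  | false = begin
      ℓ * ∑[ x < ℓ ] (a x * c x) ≡⟨ cong (ℓ *_) (sum-cong-≗ λ x → *-comm (a x) (c x)) ⟩
      ℓ * ∑[ x < ℓ ] (c x * a x) ≡⟨ sum-*-constant ℓ c a (λ x y → card-cong n (determinedBy-head-free Q-det M′₀ x y)) ⟩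
      sum c * sum a              ≡⟨ *-comm (sum c) (sum a) ⟩
      sum a * sum c              ∎

  card-all-≤ : 0 < ℓ → ∀ n m (B : Fin m → Ω n → Bool) (M : Fin m → Fin n → Bool) →
    (∀ i → DeterminedBy (M i) (B i)) → (∀ i i′ j → M i j ≡ true → M i′ j ≡ true → i ≡ i′) →
    ∀ X Y → (∀ i → card n (B i) * X ≤ Y * ℓ ^ n) →
    card n (λ f → allᵇ (λ i → B i f)) * X ^ m ≤ Y ^ m * ℓ ^ n
  card-all-≤ ℓ>0 n zero B M B-det M-disj X Y bound =
    ≤-reflexive (trans (*-identityʳ _) (trans (card-true n) (sym (*-identityˡ _))))
  card-all-≤ ℓ>0 n (suc m) B M B-det M-disj X Y bound =
    *-cancelʳ-≤-pos _ _ (ℓ ^ n) (^-pos ℓ n ℓ>0) (begin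
      c * (X * X ^ m) * ℓ ^ n          ≡⟨ xy∙z≈xz∙y c (X * X ^ m) (ℓ ^ n) ⟩
      c * ℓ ^ n * (X * X ^ m)          ≡⟨ cong (_* (X * X ^ m)) independent ⟩
      card n (B zero) * cᵣ * (X * X ^ m) ≡⟨ [m*n]*[o*p]≡[m*o]*[n*p] (card n (B zero)) cᵣ X (X ^ m) ⟩
      card n (B zero) * X * (cᵣ * X ^ m) ≤⟨ *-mono-≤ (bound zero) rest ⟩
      Y * ℓ ^ n * (Y ^ m * ℓ ^ n)        ≡⟨ [m*n]*[o*p]≡[m*o]*[n*p] Y (ℓ ^ n) (Y ^ m) (ℓ ^ n) ⟩
      Y * Y ^ m * (ℓ ^ n * ℓ ^ n)        ≡⟨ sym (*-assoc (Y * Y ^ m) (ℓ ^ n) (ℓ ^ n)) ⟩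
      Y * Y ^ m * ℓ ^ n * ℓ ^ n          ∎)
    where
    open ≤-Reasoning
    R : Ω n → Bool
    R f = allᵇ (λ i → B (suc i) f)
    c = card n (λ f → B zero f ∧ R f)
    cᵣ = card n R
    independent : c * ℓ ^ n ≡ card n (B zero) * cᵣ
    independent = card-∧-independent n (B zero) R (M zero) (λ j → anyᵇ (λ i → M (suc i) j))
      (B-det zero) (allᵇ-determinedBy (M ∘ suc) (B ∘ suc) (B-det ∘ suc))
      (disjoint-anyᵇ (M zero) (M ∘ suc) λ i j M₀j Mij → 0≢1+n (M-disj zero (suc i) j M₀j Mij))
    rest : cᵣ * X ^ m ≤ Y ^ m * ℓ ^ n
    rest = card-all-≤ ℓ>0 n m (B ∘ suc) (M ∘ suc) (B-det ∘ suc)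
      (λ i i′ j p q → suc-injective (M-disj (suc i) (suc i′) j p q)) X Y (bound ∘ suc)

suc-^-lowerBound : ∀ m s → m ^ suc s + suc s * m ^ s ≤ suc m ^ suc s
suc-^-lowerBound m zero    = ≤-reflexive (+-comm (m * 1) 1)
suc-^-lowerBound m (suc s) = begin
  m * (m * m ^ s) + suc (suc s) * (m * m ^ s)                   ≤⟨ m≤m+n _ (suc s * m ^ s) ⟩
  m * (m * m ^ s) + suc (suc s) * (m * m ^ s) + suc s * m ^ s   ≡⟨ regroup (m ^ s) (suc s) m ⟩
  suc m * (m * m ^ s + suc s * m ^ s)                           ≤⟨ *-monoʳ-≤ (suc m) (suc-^-lowerBound m s) ⟩
  suc m * suc m ^ suc s                                         ∎
  where
  open ≤-Reasoning
  regroup : ∀ q s m → m * (m * q) + (1 + s) * (m * q) + s * q ≡ (1 + m) * (m * q + s * q)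
  regroup = solve-∀

suc-^-upperBound : ∀ c s → suc c ^ suc s ≤ c ^ suc s + suc s * suc c ^ s
suc-^-upperBound c zero    = ≤-reflexive (+-comm 1 (c * 1))
suc-^-upperBound c (suc s) = begin
  suc c * suc c ^ suc s                               ≤⟨ *-monoʳ-≤ (suc c) (suc-^-upperBound c s) ⟩
  suc c * (c ^ suc s + suc s * suc c ^ s)             ≡⟨ regroup c (c ^ suc s) (suc s) (suc c ^ s) ⟩
  c * c ^ suc s + (c ^ suc s + suc s * suc c ^ suc s) ≤⟨ +-monoʳ-≤ (c * c ^ suc s)
                                                          (+-monoˡ-≤ _ (^-monoˡ-≤ (suc s) (n≤1+n c))) ⟩
  c * c ^ suc s + (suc c ^ suc s + suc s * suc c ^ suc s) ∎
  where
  open ≤-Reasoning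
  regroup : ∀ c p s q → suc c * (p + s * q) ≡ c * p + (p + s * (suc c * q))
  regroup = solve-∀

atLeast : ℕ → ℕ → Bool
atLeast zero    _       = true
atLeast (suc s) zero    = false
atLeast (suc s) (suc h) = atLeast s h

atLeast-false : ∀ s h → atLeast s h ≡ false → h < s
atLeast-false (suc s) zero    _     = s≤s z≤n
atLeast-false (suc s) (suc h) h≱s = s≤s (atLeast-false s h h≱s)

atLeast-suc-+ : ∀ x h s → b2n (atLeast (suc s) (b2n x + h)) ≤ b2n x * b2n (atLeast s h) + b2n (atLeast (suc s) h)
atLeast-suc-+ true  h s = ≤-trans (≤-reflexive (sym (+-identityʳ _))) (m≤m+n _ _)
atLeast-suc-+ false h s = ≤-refl

_==_ : ∀ {m} → Fin m → Fin m → Bool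
x == k = toℕ x ≡ᵇ toℕ k

==-refl : ∀ {m} (i : Fin m) → (i == i) ≡ true
==-refl i = ≡ᵇ-refl (toℕ i)
  where
  ≡ᵇ-refl : ∀ x → (x ≡ᵇ x) ≡ true
  ≡ᵇ-refl zero    = refl
  ≡ᵇ-refl (suc x) = ≡ᵇ-refl x

==⇒≡ : ∀ {m} (i j : Fin m) → (i == j) ≡ true → i ≡ j
==⇒≡ i j i==j = toℕ-injective (≡ᵇ⇒≡ (toℕ i) (toℕ j) (Equivalence.from T-≡ i==j))

count-== : ∀ m (k : Fin m) → count (λ x → x == k) ≡ 1
count-== (suc m) zero    = cong suc (count-false m)
count-== (suc m) (suc k) = count-== m k

module ColourHits (ℓ : ℕ) where

  open Outcomes ℓ

  hits : ∀ {n} → (Fin n → Bool) → Fin ℓ → Ω n → ℕ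
  hits M k f = count (λ j → M j ∧ (f j == k))

  card-atLeast-head≤ : ∀ n (h : Ω n → ℕ) k s →
    ∑[ x < ℓ ] card n (λ g → atLeast (suc s) (b2n (x == k) + h g))
      ≤ card n (atLeast s ∘ h) + ℓ * card n (atLeast (suc s) ∘ h)
  card-atLeast-head≤ n h k s = begin
    ∑[ x < ℓ ] card n (λ g → atLeast (suc s) (b2n (x == k) + h g)) ≤⟨ sum-mono-≤ per-colour ⟩
    ∑[ x < ℓ ] (b2n (x == k) * F₀ + F₁)                            ≡⟨ ∑-distrib-+ {ℓ} _ _ ⟩
    ∑[ x < ℓ ] (b2n (x == k) * F₀) + ∑[ x < ℓ ] F₁                 ≡⟨ cong₂ _+_ one-colour-is-k (sum-const ℓ F₁) ⟩
    F₀ + ℓ * F₁                                                    ∎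
    where
    open ≤-Reasoning
    F₀ = card n (atLeast s ∘ h)
    F₁ = card n (atLeast (suc s) ∘ h)
    per-colour : ∀ x → card n (λ g → atLeast (suc s) (b2n (x == k) + h g)) ≤ b2n (x == k) * F₀ + F₁
    per-colour x = ≤-trans (∑Ω-mono-≤ n (λ g → atLeast-suc-+ (x == k) (h g) s))
      (≤-reflexive (trans (∑Ω-distrib-+ n _ _) (cong (_+ F₁) (*-distribˡ-∑Ω n (b2n (x == k)) _))))
    one-colour-is-k : ∑[ x < ℓ ] (b2n (x == k) * F₀) ≡ F₀
    one-colour-is-k = begin-equality
      ∑[ x < ℓ ] (b2n (x == k) * F₀) ≡⟨ sym (*-distribʳ-sum {ℓ} F₀ _) ⟩
      ∑[ x < ℓ ] b2n (x == k) * F₀   ≡⟨ cong (_* F₀) (trans (sym (count≡sum {ℓ} _)) (count-== ℓ k)) ⟩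
      1 * F₀                         ≡⟨ *-identityˡ F₀ ⟩
      F₀                             ∎

  card-hits≥ : ∀ n (M : Fin n → Bool) k s →
    card n (λ f → atLeast s (hits M k f)) * (ℓ ^ s * s !) ≤ count M ^ s * ℓ ^ n
  card-hits≥ n M k zero = ≤-reflexive (begin-equality
    card n (λ _ → true) * 1 ≡⟨ *-identityʳ _ ⟩
    card n (λ _ → true)     ≡⟨ card-true n ⟩
    ℓ ^ n                   ≡⟨ sym (*-identityˡ _) ⟩
    1 * ℓ ^ n               ∎)
    where open ≤-Reasoning
  card-hits≥ zero    M k (suc s) = z≤n
  card-hits≥ (suc n) M k (suc s) with M zero
  ... | false = begin
    ∑[ x < ℓ ] F₁ * (ℓ ^ suc s * suc s !) ≡⟨ cong (_* (ℓ ^ suc s * suc s !)) (sum-const ℓ F₁) ⟩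
    ℓ * F₁ * (ℓ ^ suc s * suc s !)        ≡⟨ *-assoc ℓ F₁ _ ⟩
    ℓ * (F₁ * (ℓ ^ suc s * suc s !))      ≤⟨ *-monoʳ-≤ ℓ (card-hits≥ n M′ k (suc s)) ⟩
    ℓ * (m ^ suc s * ℓ ^ n)               ≡⟨ x∙yz≈y∙xz ℓ (m ^ suc s) (ℓ ^ n) ⟩
    m ^ suc s * (ℓ * ℓ ^ n)               ∎
    where
    open ≤-Reasoning
    M′ = M ∘ suc
    m = count M′
    F₁ = card n (λ g → atLeast (suc s) (hits M′ k g))
  ... | true = begin
    ∑[ x < ℓ ] card n (λ g → atLeast (suc s) (b2n (x == k) + hits M′ k g)) * (ℓ ^ suc s * suc s !)
      ≤⟨ *-monoˡ-≤ _ (card-atLeast-head≤ n (hits M′ k) k s) ⟩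
    (F₀ + ℓ * F₁) * (ℓ * ℓ ^ s * (suc s * s !))
      ≡⟨ distribute F₀ F₁ ℓ (ℓ ^ s) (s !) s ⟩
    ℓ * suc s * (F₀ * (ℓ ^ s * s !)) + ℓ * (F₁ * (ℓ * ℓ ^ s * (suc s * s !)))
      ≤⟨ +-mono-≤ (*-monoʳ-≤ (ℓ * suc s) (card-hits≥ n M′ k s)) (*-monoʳ-≤ ℓ (card-hits≥ n M′ k (suc s))) ⟩
    ℓ * suc s * (m ^ s * ℓ ^ n) + ℓ * (m ^ suc s * ℓ ^ n)
      ≡⟨ collect ℓ s (m ^ s) (ℓ ^ n) (m ^ suc s) ⟩
    (m ^ suc s + suc s * m ^ s) * (ℓ * ℓ ^ n)
      ≤⟨ *-monoˡ-≤ (ℓ * ℓ ^ n) (suc-^-lowerBound m s) ⟩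
    suc m ^ suc s * (ℓ * ℓ ^ n) ∎
    where
    open ≤-Reasoning
    M′ = M ∘ suc
    m = count M′
    F₀ = card n (λ g → atLeast s (hits M′ k g))
    F₁ = card n (λ g → atLeast (suc s) (hits M′ k g))
    distribute : ∀ F₀ F₁ L P Q s → (F₀ + L * F₁) * (L * P * ((1 + s) * Q))
      ≡ L * (1 + s) * (F₀ * (P * Q)) + L * (F₁ * (L * P * ((1 + s) * Q)))
    distribute = solve-∀
    collect : ∀ L s mˢ Lⁿ mˢ⁺¹ → L * (1 + s) * (mˢ * Lⁿ) + L * (mˢ⁺¹ * Lⁿ) ≡ (mˢ⁺¹ + (1 + s) * mˢ) * (L * Lⁿ)
    collect = solve-∀

<ᵇ-suc⇒≡ : ∀ m j → (m <ᵇ suc j) ≡ true → (m <ᵇ j) ≡ false → m ≡ j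
<ᵇ-suc⇒≡ zero    zero    _ _  = refl
<ᵇ-suc⇒≡ (suc m) (suc j) p q  = cong suc (<ᵇ-suc⇒≡ m j p q)
<ᵇ-suc⇒≡ (suc m) zero    () _
<ᵇ-suc⇒≡ zero    (suc j) _ ()

module LocalLemma (ℓ : ℕ) (ℓ>0 : 0 < ℓ) (n a : ℕ)
  (A : Fin a → Outcomes.Ω ℓ n → Bool) (M : Fin a → Fin n → Bool)
  (A-det : ∀ u → Outcomes.DeterminedBy ℓ (M u) (A u))
  (dep : Fin a → Fin a → Bool)
  (independent : ∀ v u → dep v u ≡ false → Outcomes.Disjoint ℓ (M v) (M u))
  (D : ℕ) (D>0 : 0 < D) (dep-count : ∀ v → count (dep v) ≤ D)
  (card-A : ∀ v → Outcomes.card ℓ n (A v) * (4 * D) ≤ ℓ ^ n) where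

  open Outcomes ℓ

  avoids : (Fin a → Bool) → Ω n → Bool
  avoids S f = allᵇ (λ u → not (S u ∧ A u f))

  support : (Fin a → Bool) → Fin n → Bool
  support S j = anyᵇ (λ u → S u ∧ M u j)

  avoids-determinedBy : ∀ S → DeterminedBy (support S) (avoids S)
  avoids-determinedBy S = allᵇ-determinedBy (λ u j → S u ∧ M u j) (λ u f → not (S u ∧ A u f)) each
    where
    each : ∀ u → DeterminedBy (λ j → S u ∧ M u j) (λ f → not (S u ∧ A u f))
    each u f g f≈g with S u
    ... | false = refl
    ... | true  = cong not (A-det u f g f≈g)

  avoids-antitone : ∀ S S′ → (∀ u → S′ u ≡ true → S u ≡ true) → ∀ f → avoids S f ≡ true → avoids S′ f ≡ true
  avoids-antitone S S′ S′⊆S f avoids-S =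
    allᵇ-intro _ λ u → weaken (S u) (S′ u) (A u f) (S′⊆S u) (allᵇ-elim _ avoids-S u)
    where
    weaken : ∀ s s′ α → (s′ ≡ true → s ≡ true) → not (s ∧ α) ≡ true → not (s′ ∧ α) ≡ true
    weaken s     false α _   _ = refl
    weaken false true  α s′⇒s _ with s′⇒s refl
    ... | ()
    weaken true  true  α _   h = h

  dependents others : Fin a → (Fin a → Bool) → Fin a → Bool
  dependents v S u = S u ∧ dep v u
  others     v S u = S u ∧ not (dep v u)

  count-split : ∀ v S → count S ≡ count (dependents v S) + count (others v S)
  count-split v S = begin
    count S                                                 ≡⟨ count≡sum S ⟩
    ∑[ u < a ] b2n (S u)                                    ≡⟨ sum-cong-≗ (λ u → split (S u) (dep v u)) ⟩
    ∑[ u < a ] (b2n (dependents v S u) + b2n (others v S u)) ≡⟨ ∑-distrib-+ (b2n ∘ dependents v S) (b2n ∘ others v S) ⟩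
    ∑[ u < a ] b2n (dependents v S u) + ∑[ u < a ] b2n (others v S u)
                                                            ≡⟨ sym (cong₂ _+_ (count≡sum (dependents v S)) (count≡sum (others v S))) ⟩
    count (dependents v S) + count (others v S)             ∎
    where
    open ≡-Reasoning
    split : ∀ s d → b2n s ≡ b2n (s ∧ d) + b2n (s ∧ not d)
    split false d     = refl
    split true  true  = refl
    split true  false = refl

  others-smaller : ∀ v S u → dependents v S u ≡ true → suc (count (others v S)) ≤ count S
  others-smaller v S u dep-u = begin
    1 + count (others v S)                      ≤⟨ +-monoˡ-≤ _ (count-pos (dependents v S) u dep-u) ⟩
    count (dependents v S) + count (others v S) ≡⟨ sym (count-split v S) ⟩
    count S                                     ∎
    where open ≤-Reasoning

  -- Removing the events dependent on v makes avoidance independent of A v.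
  card-A∧avoids≤ : ∀ v S → card n (λ f → A v f ∧ avoids S f) * (4 * D) ≤ card n (avoids (others v S))
  card-A∧avoids≤ v S = *-cancelʳ-≤-pos _ _ (ℓ ^ n) (^-pos ℓ n ℓ>0) (begin
    x * (4 * D) * ℓ ^ n        ≤⟨ *-monoˡ-≤ (ℓ ^ n) (*-monoˡ-≤ (4 * D) x≤y) ⟩
    y * (4 * D) * ℓ ^ n        ≡⟨ xy∙z≈xz∙y y (4 * D) (ℓ ^ n) ⟩
    y * ℓ ^ n * (4 * D)        ≡⟨ cong (_* (4 * D)) y-independent ⟩
    card n (A v) * g * (4 * D) ≡⟨ xy∙z≈xz∙y (card n (A v)) g (4 * D) ⟩
    card n (A v) * (4 * D) * g ≤⟨ *-monoˡ-≤ g (card-A v) ⟩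
    ℓ ^ n * g                  ≡⟨ *-comm (ℓ ^ n) g ⟩
    g * ℓ ^ n                  ∎)
    where
    open ≤-Reasoning
    x = card n (λ f → A v f ∧ avoids S f)
    y = card n (λ f → A v f ∧ avoids (others v S) f)
    g = card n (avoids (others v S))
    x≤y : x ≤ y
    x≤y = card-mono n _ _ λ f Av∧avoids → let (Av , avoids-S) = ∧-true Av∧avoids in
      cong₂ _∧_ Av (avoids-antitone S (others v S) (λ _ → proj₁ ∘ ∧-true) f avoids-S)
    y-independent : y * ℓ ^ n ≡ card n (A v) * g
    y-independent = card-∧-independent n (A v) (avoids (others v S)) (M v) (support (others v S))
      (A-det v) (avoids-determinedBy (others v S))
      (disjoint-anyᵇ (M v) (λ u j → others v S u ∧ M u j) λ u j Mvj others∧Muj →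
        let (others-u , Muj) = ∧-true others∧Muj in
        independent v u (not-true (proj₂ (∧-true others-u))) j Mvj Muj)

  ∑dependents : Fin a → (Fin a → Bool) → ℕ
  ∑dependents v S = ∑[ u < a ] card n (λ f → dependents v S u ∧ (A u f ∧ avoids (others v S) f))

  card-avoids-others≤ : ∀ v S → card n (avoids (others v S)) ≤ card n (avoids S) + ∑dependents v S
  card-avoids-others≤ v S = begin
    card n (avoids (others v S))                 ≤⟨ ∑Ω-mono-≤ n pointwise ⟩
    ∑Ω n (λ f → b2n (avoids S f) + term f)       ≡⟨ ∑Ω-distrib-+ n _ _ ⟩
    card n (avoids S) + ∑Ω n term                ≡⟨ cong (card n (avoids S) +_) (∑Ω-comm n a _) ⟩
    card n (avoids S) + ∑dependents v S          ∎
    where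
    open ≤-Reasoning
    term : Ω n → ℕ
    term f = ∑[ u < a ] b2n (dependents v S u ∧ (A u f ∧ avoids (others v S) f))
    witness : ∀ s d α → not (s ∧ α) ≡ false → not ((s ∧ not d) ∧ α) ≡ true → (s ∧ d) ∧ (α ∧ true) ≡ true
    witness true  true  true _ _  = refl
    witness true  false true _ ()
    witness false _     _    ()
    witness true  _     false ()
    pointwise : ∀ f → b2n (avoids (others v S) f) ≤ b2n (avoids S f) + term f
    pointwise f with avoids S f in avoids-S
    ... | true = ≤-trans (b2n≤1 _) (m≤m+n 1 _)
    ... | false with avoids (others v S) f in avoids-others
    ...   | false = z≤n
    ...   | true with allᵇ-false _ avoids-S
    ...     | u , hit = ≤-trans (≤-reflexive (cong b2n (sym u-counts))) (term≤sum _ u)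
      where
      u-counts : dependents v S u ∧ (A u f ∧ true) ≡ true
      u-counts = witness (S u) (dep v u) (A u f) hit (allᵇ-elim _ avoids-others u)

  ∑dependents≤ : ∀ v S →
    (∀ u → dependents v S u ≡ true →
      card n (λ f → A u f ∧ avoids (others v S) f) * (2 * D) ≤ card n (avoids (others v S))) →
    ∑dependents v S * (2 * D) ≤ D * card n (avoids (others v S))
  ∑dependents≤ v S bound = begin
    ∑dependents v S * (2 * D)                   ≡⟨ *-distribʳ-sum {a} (2 * D) _ ⟩
    ∑[ u < a ] (card n (event u) * (2 * D))    ≤⟨ sum-mono-≤ per-event ⟩
    ∑[ u < a ] (b2n (dependents v S u) * g)    ≡⟨ sym (*-distribʳ-sum {a} g _) ⟩
    ∑[ u < a ] b2n (dependents v S u) * g      ≡⟨ cong (_* g) (sym (count≡sum (dependents v S))) ⟩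
    count (dependents v S) * g                  ≤⟨ *-monoˡ-≤ g (≤-trans dependents⊆dep (dep-count v)) ⟩
    D * g                                       ∎
    where
    open ≤-Reasoning
    g = card n (avoids (others v S))
    event : Fin a → Ω n → Bool
    event u f = dependents v S u ∧ (A u f ∧ avoids (others v S) f)
    per-event : ∀ u → card n (event u) * (2 * D) ≤ b2n (dependents v S u) * g
    per-event u with dependents v S u in dep-u
    ... | false = ≤-reflexive (cong (_* (2 * D)) (card-empty n _ λ _ → refl))
    ... | true  = ≤-trans (bound u dep-u) (≤-reflexive (sym (+-identityʳ g)))
    dependents⊆dep : count (dependents v S) ≤ count (dep v)
    dependents⊆dep = count-mono (dependents v S) (dep v) λ _ → proj₂ ∘ ∧-true

  conditional-bound : ∀ k S → count S ≤ k → ∀ v →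
    card n (λ f → A v f ∧ avoids S f) * (2 * D) ≤ card n (avoids S)
  conditional-bound k S |S|≤k v =
    halve x (card n (avoids S)) (card n (avoids (others v S))) (∑dependents v S)
      (card-A∧avoids≤ v S) (card-avoids-others≤ v S) (∑dependents≤ v S (induction k |S|≤k))
    where
    x = card n (λ f → A v f ∧ avoids S f)
    induction : ∀ k → count S ≤ k → ∀ u → dependents v S u ≡ true →
      card n (λ f → A u f ∧ avoids (others v S) f) * (2 * D) ≤ card n (avoids (others v S))
    induction zero    |S|≤0   u dep-u = ⊥-elim (n≮0 (≤-trans (others-smaller v S u dep-u) |S|≤0))
    induction (suc k) |S|≤1+k u dep-u =
      conditional-bound k (others v S) (≤-pred (≤-trans (others-smaller v S u dep-u) |S|≤1+k)) u
    halve : ∀ x g g′ σ → x * (4 * D) ≤ g′ → g′ ≤ g + σ → σ * (2 * D) ≤ D * g′ → x * (2 * D) ≤ g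
    halve x g g′ σ x≤g′ g′≤g+σ σ≤ = *-cancelˡ-≤ 2 (begin
      2 * (x * (2 * D)) ≡⟨ reassociate x D ⟩
      x * (4 * D)       ≤⟨ x≤g′ ⟩
      g′                ≤⟨ g′≤2g ⟩
      2 * g             ∎)
      where
      open ≤-Reasoning
      reassociate : ∀ x D → 2 * (x * (2 * D)) ≡ x * (4 * D)
      reassociate = solve-∀
      g′≤2g : g′ ≤ 2 * g
      g′≤2g = *-cancelˡ-≤ D {{>-nonZero D>0}} (+-cancelʳ-≤ (D * g′) (D * g′) (D * (2 * g)) (begin
        D * g′ + D * g′       ≡⟨ double D g′ ⟩
        2 * D * g′            ≤⟨ *-monoʳ-≤ (2 * D) g′≤g+σ ⟩
        2 * D * (g + σ)       ≡⟨ expand D g σ ⟩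
        D * (2 * g) + σ * (2 * D) ≤⟨ +-monoʳ-≤ (D * (2 * g)) σ≤ ⟩
        D * (2 * g) + D * g′  ∎))
        where
        double : ∀ D g → D * g + D * g ≡ 2 * D * g
        double = solve-∀
        expand : ∀ D g σ → 2 * D * (g + σ) ≡ D * (2 * g) + σ * (2 * D)
        expand = solve-∀

  first : ℕ → Fin a → Bool
  first j u = toℕ u <ᵇ j

  avoids-first-suc : ∀ j (j<a : j < a) f → A (fromℕ< j<a) f ≡ false →
    avoids (first j) f ≡ true → avoids (first (suc j)) f ≡ true
  avoids-first-suc j j<a f Aj-false avoids-j = allᵇ-intro _ each
    where
    each : ∀ u → not (first (suc j) u ∧ A u f) ≡ true
    each u with toℕ u <ᵇ suc j in u≤j
    ... | false = refl
    ... | true with toℕ u <ᵇ j in u<j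
    ...   | true  = subst (λ b → not (b ∧ A u f) ≡ true) u<j (allᵇ-elim _ avoids-j u)
    ...   | false = subst (λ w → not (A w f) ≡ true) (sym u≡j) (cong not Aj-false)
      where
      u≡j : u ≡ fromℕ< j<a
      u≡j = toℕ-injective (trans (<ᵇ-suc⇒≡ (toℕ u) j u≤j u<j) (sym (toℕ-fromℕ< j<a)))

  card-avoids-first-pos : ∀ j → j ≤ a → 1 ≤ card n (avoids (first j))
  card-avoids-first-pos zero    _   = subst (1 ≤_) (sym (trans (card-cong n nothing-to-avoid) (card-true n))) (^-pos ℓ n ℓ>0)
    where
    nothing-to-avoid : ∀ f → avoids (first zero) f ≡ true
    nothing-to-avoid f = allᵇ-intro (λ u → not (first zero u ∧ A u f)) λ _ → refl
  card-avoids-first-pos (suc j) j<a =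
    remainder-pos (card-avoids-first-pos j (≤-trans (n≤1+n j) j<a)) split
      (conditional-bound (count (first j)) (first j) ≤-refl (fromℕ< j<a))
    where
    u = fromℕ< j<a
    pointwise : ∀ f → b2n (avoids (first j) f) ≤ b2n (avoids (first (suc j)) f) + b2n (A u f ∧ avoids (first j) f)
    pointwise f with A u f in Au
    ... | true  = m≤n+m _ _
    ... | false with avoids (first j) f in avoids-j
    ...   | false = z≤n
    ...   | true  = ≤-trans (≤-reflexive (cong b2n (sym (avoids-first-suc j j<a f Au avoids-j)))) (m≤m+n _ _)
    split : card n (avoids (first j)) ≤ card n (avoids (first (suc j))) + card n (λ f → A u f ∧ avoids (first j) f)
    split = ≤-trans (∑Ω-mono-≤ n pointwise) (≤-reflexive (∑Ω-distrib-+ n _ _))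
    remainder-pos : ∀ {g g′ x} → 1 ≤ g → g ≤ g′ + x → x * (2 * D) ≤ g → 1 ≤ g′
    remainder-pos {g′ = suc _} _ _ _ = s≤s z≤n
    remainder-pos {g} {zero} {x} g>0 g≤x x2D≤g = ⊥-elim (<-irrefl refl (begin-strict
      g           ≤⟨ g≤x ⟩
      x           <⟨ m<m*n x (2 * D) {{>-nonZero (≤-trans g>0 g≤x)}} (*-monoʳ-≤ 2 D>0) ⟩
      x * (2 * D) ≤⟨ x2D≤g ⟩
      g           ∎))
      where open ≤-Reasoning

  avoid-all : ∃[ f ] ∀ v → A v f ≡ false
  avoid-all with card-pos⇒witness n (avoids (first a)) (card-avoids-first-pos a ≤-refl)
  ... | f , avoids-all = f , λ v → not-true (subst (λ b → not (b ∧ A v f) ≡ true)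
                                               (Equivalence.to T-≡ (<⇒<ᵇ (toℕ<n v))) (allᵇ-elim _ avoids-all v))

sum< : ℕ → (ℕ → ℕ) → ℕ
sum< zero    f = 0
sum< (suc m) f = sum< m f + f m

sum<-cong : ∀ m {f g : ℕ → ℕ} → (∀ k → k < m → f k ≡ g k) → sum< m f ≡ sum< m g
sum<-cong zero    f≗g = refl
sum<-cong (suc m) f≗g = cong₂ _+_ (sum<-cong m λ k k<m → f≗g k (m<n⇒m<1+n k<m)) (f≗g m ≤-refl)

sum<-mono-≤ : ∀ m {f g : ℕ → ℕ} → (∀ k → k < m → f k ≤ g k) → sum< m f ≤ sum< m g
sum<-mono-≤ zero    f≤g = z≤n
sum<-mono-≤ (suc m) f≤g = +-mono-≤ (sum<-mono-≤ m λ k k<m → f≤g k (m<n⇒m<1+n k<m)) (f≤g m ≤-refl)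

sum<-distrib-+ : ∀ m (f g : ℕ → ℕ) → sum< m (λ k → f k + g k) ≡ sum< m f + sum< m g
sum<-distrib-+ zero    f g = refl
sum<-distrib-+ (suc m) f g = trans (cong (_+ (f m + g m)) (sum<-distrib-+ m f g))
                                   (+-+-interchange (sum< m f) (sum< m g) (f m) (g m))
  where
  +-+-interchange : ∀ p q x y → p + q + (x + y) ≡ p + x + (q + y)
  +-+-interchange = solve-∀

*-distribˡ-sum< : ∀ m c (f : ℕ → ℕ) → sum< m (λ k → c * f k) ≡ c * sum< m f
*-distribˡ-sum< zero    c f = sym (*-zeroʳ c)
*-distribˡ-sum< (suc m) c f =
  trans (cong (_+ c * f m) (*-distribˡ-sum< m c f)) (sym (*-distribˡ-+ c (sum< m f) (f m)))

sum<-suc-head : ∀ m (f : ℕ → ℕ) → sum< (suc m) f ≡ f 0 + sum< m (f ∘ suc)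
sum<-suc-head zero    f = +-comm 0 (f 0)
sum<-suc-head (suc m) f = trans (cong (_+ f (suc m)) (sum<-suc-head m f)) (+-assoc (f 0) _ _)

ascending : ℕ → ℕ → ℕ
ascending j zero    = 1
ascending j (suc k) = (j + suc k) * ascending j k

ascending-! : ∀ j k → ascending j k * j ! ≡ (j + k) !
ascending-! j zero    = trans (+-identityʳ _) (cong _! (sym (+-identityʳ j)))
ascending-! j (suc k) = begin
  (j + suc k) * ascending j k * j ! ≡⟨ *-assoc (j + suc k) _ _ ⟩
  (j + suc k) * (ascending j k * j !) ≡⟨ cong ((j + suc k) *_) (ascending-! j k) ⟩
  (j + suc k) * (j + k) !           ≡⟨ cong (λ m → m * (j + k) !) (+-suc j k) ⟩
  suc (j + k) !                     ≡⟨ cong _! (sym (+-suc j k)) ⟩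
  (j + suc k) !                     ∎
  where open ≡-Reasoning

*-cancelʳ-! : ∀ x y j → x * j ! ≡ y * j ! → x ≡ y
*-cancelʳ-! x y j = *-cancelʳ-≡ x y (j !) {{j !≢0}}

ascending-suc : ∀ k m → ascending k (suc m) ≡ suc k * ascending (suc k) m
ascending-suc k m = *-cancelʳ-! _ _ k (begin
  ascending k (suc m) * k !               ≡⟨ ascending-! k (suc m) ⟩
  (k + suc m) !                           ≡⟨ cong _! (+-suc k m) ⟩
  (suc k + m) !                           ≡⟨ sym (ascending-! (suc k) m) ⟩
  ascending (suc k) m * (suc k * k !)     ≡⟨ x∙yz≈yx∙z (ascending (suc k) m) (suc k) (k !) ⟩
  suc k * ascending (suc k) m * k !       ∎)
  where open ≡-Reasoning

-- ratio n k = n! / k! for k ≤ n.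
ratio : ℕ → ℕ → ℕ
ratio n k = ascending k (n ∸ k)

ratio-step : ∀ n k → k < n → ratio n k ≡ suc k * ratio n (suc k)
ratio-step n k k<n = trans (cong (ascending k) (+-∸-assoc 1 k<n)) (ascending-suc k (n ∸ suc k))

ratio-zero : ∀ n → ratio n 0 ≡ n !
ratio-zero n = trans (sym (*-identityʳ _)) (ascending-! 0 n)

ratio-self : ∀ n → ratio n n ≡ 1
ratio-self n = cong (ascending n) (n∸n≡0 n)

ratio-suc : ∀ n j → j ≤ n → ratio (suc n) j ≡ suc n * ratio n j
ratio-suc n j j≤n = begin
  ascending j (suc n ∸ j)           ≡⟨ cong (ascending j) (+-∸-assoc 1 j≤n) ⟩
  (j + suc (n ∸ j)) * ratio n j     ≡⟨ cong (_* ratio n j) (trans (+-suc j (n ∸ j)) (cong suc (m+[n∸m]≡n j≤n))) ⟩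
  suc n * ratio n j                 ∎
  where open ≡-Reasoning

expNum-as-sum : ∀ x n → expNum x n ≡ sum< (suc n) (λ j → x ^ j * ratio n j)
expNum-as-sum x zero    = refl
expNum-as-sum x (suc n) = begin
  suc n * expNum x n + x ^ suc n
    ≡⟨ cong₂ _+_ (cong (suc n *_) (expNum-as-sum x n)) (sym (trans (cong (x ^ suc n *_) (ratio-self (suc n))) (*-identityʳ _))) ⟩
  suc n * sum< (suc n) (λ j → x ^ j * ratio n j) + x ^ suc n * ratio (suc n) (suc n)
    ≡⟨ cong (_+ x ^ suc n * ratio (suc n) (suc n)) (trans (sym (*-distribˡ-sum< (suc n) (suc n) _))
         (sum<-cong (suc n) λ j j≤n → trans (x∙yz≈y∙xz (suc n) (x ^ j) (ratio n j))
                                             (cong (x ^ j *_) (sym (ratio-suc n j (≤-pred j≤n)))))) ⟩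
  sum< (suc n) (λ j → x ^ j * ratio (suc n) j) + x ^ suc n * ratio (suc n) (suc n) ∎
  where open ≡-Reasoning

expTerm-step : ∀ n x k → k < n → x * (x ^ k * ratio n k) ≡ suc k * (x ^ suc k * ratio n (suc k))
expTerm-step n x k k<n = trans (cong (λ r → x * (x ^ k * r)) (ratio-step n k k<n)) (shuffle x (x ^ k) (suc k) _)
  where
  shuffle : ∀ x p s q → x * (p * (s * q)) ≡ s * (x * p * q)
  shuffle = solve-∀

module CauchyProduct (a b n : ℕ) where

  g h : ℕ → ℕ
  g k = a ^ k * ratio n k
  h l = b ^ l * ratio n l

  convolution : ℕ → ℕ
  convolution j = sum< (suc j) (λ k → g k * h (j ∸ k))

  convolution-step : ∀ j → j < n → (a + b) * convolution j ≡ suc j * convolution (suc j)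
  convolution-step j j<n = begin
    (a + b) * convolution j                           ≡⟨ sym (*-distribˡ-sum< (suc j) (a + b) _) ⟩
    sum< (suc j) (λ k → (a + b) * (g k * h (j ∸ k))) ≡⟨ sum<-cong (suc j) (λ k k≤j → split k (≤-pred k≤j)) ⟩
    sum< (suc j) (λ k → φ (suc k) + ψ k)              ≡⟨ sum<-distrib-+ (suc j) _ _ ⟩
    sum< (suc j) (φ ∘ suc) + sum< (suc j) ψ           ≡⟨ cong₂ _+_ (sym (sum<-suc-head (suc j) φ))
                                                               (sym (trans (cong (sum< (suc j) ψ +_) ψ-last) (+-identityʳ _))) ⟩
    sum< (suc (suc j)) φ + sum< (suc (suc j)) ψ       ≡⟨ sym (sum<-distrib-+ (suc (suc j)) φ ψ) ⟩
    sum< (suc (suc j)) (λ k → φ k + ψ k)              ≡⟨ sum<-cong (suc (suc j)) (λ k k≤j+1 → merge k (≤-pred k≤j+1)) ⟩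
    sum< (suc (suc j)) (λ k → suc j * (g k * h (suc j ∸ k))) ≡⟨ *-distribˡ-sum< (suc (suc j)) (suc j) _ ⟩
    suc j * convolution (suc j)                       ∎
    where
    open ≡-Reasoning
    φ ψ : ℕ → ℕ
    φ k = k * (g k * h (suc j ∸ k))
    ψ k = (suc j ∸ k) * (g k * h (suc j ∸ k))
    ψ-last : ψ (suc j) ≡ 0
    ψ-last = cong (_* (g (suc j) * h (suc j ∸ suc j))) (n∸n≡0 j)
    split : ∀ k → k ≤ j → (a + b) * (g k * h (j ∸ k)) ≡ φ (suc k) + ψ k
    split k k≤j = begin
      (a + b) * (g k * h (j ∸ k))                                ≡⟨ distribute a b (g k) (h (j ∸ k)) ⟩
      a * g k * h (j ∸ k) + g k * (b * h (j ∸ k))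
        ≡⟨ cong₂ _+_ (cong (_* h (j ∸ k)) (expTerm-step n a k (≤-<-trans k≤j j<n)))
                     (cong (g k *_) (expTerm-step n b (j ∸ k) (≤-<-trans (m∸n≤m j k) j<n))) ⟩
      suc k * g (suc k) * h (j ∸ k) + g k * (suc (j ∸ k) * h (suc (j ∸ k)))
        ≡⟨ cong₂ _+_ (*-assoc (suc k) (g (suc k)) _)
                     (trans (x∙yz≈y∙xz (g k) (suc (j ∸ k)) _) (cong (λ l → l * (g k * h l)) (sym (+-∸-assoc 1 k≤j)))) ⟩
      φ (suc k) + ψ k                                             ∎
      where
      distribute : ∀ a b p q → (a + b) * (p * q) ≡ a * p * q + p * (b * q)
      distribute = solve-∀
    merge : ∀ k → k ≤ suc j → φ k + ψ k ≡ suc j * (g k * h (suc j ∸ k))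
    merge k k≤ = trans (sym (*-distribʳ-+ (g k * h (suc j ∸ k)) k (suc j ∸ k)))
                       (cong (_* (g k * h (suc j ∸ k))) (m+[n∸m]≡n k≤))

  binomial : ∀ j → j ≤ n → n ! * ((a + b) ^ j * ratio n j) ≡ convolution j
  binomial zero _ = cong (_* (1 * ratio n 0)) (sym (trans (*-identityˡ _) (ratio-zero n)))
  binomial (suc j) j<n = *-cancelˡ-≡ _ _ (suc j) (begin
    suc j * (n ! * ((a + b) ^ suc j * ratio n (suc j)))     ≡⟨ shuffle (suc j) (n !) (a + b) ((a + b) ^ j) (ratio n (suc j)) ⟩
    (a + b) * (n ! * ((a + b) ^ j * (suc j * ratio n (suc j))))
      ≡⟨ cong (λ r → (a + b) * (n ! * ((a + b) ^ j * r))) (sym (ratio-step n j j<n)) ⟩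
    (a + b) * (n ! * ((a + b) ^ j * ratio n j))             ≡⟨ cong ((a + b) *_) (binomial j (≤-trans (n≤1+n j) j<n)) ⟩
    (a + b) * convolution j                                  ≡⟨ convolution-step j j<n ⟩
    suc j * convolution (suc j)                              ∎)
    where
    open ≡-Reasoning
    shuffle : ∀ s N x p q → s * (N * (x * p * q)) ≡ x * (N * (p * (s * q)))
    shuffle = solve-∀

  H : ℕ → ℕ
  H p = sum< p h

  H-mono : ∀ {p q} → p ≤ q → H p ≤ H q
  H-mono {q = zero}  z≤n = z≤n
  H-mono {p} {suc q} p≤ with m≤n⇒m<n∨m≡n p≤
  ... | inj₁ p<1+q = ≤-trans (H-mono (≤-pred p<1+q)) (m≤m+n _ _)
  ... | inj₂ refl  = ≤-refl

  sum-convolution : ∀ m → sum< m convolution ≡ sum< m (λ k → g k * H (m ∸ k))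
  sum-convolution zero    = refl
  sum-convolution (suc m) = begin
    sum< m convolution + convolution m                 ≡⟨ cong (_+ convolution m) (sum-convolution m) ⟩
    S + (S′ + g m * h (m ∸ m))                         ≡⟨ cong (λ l → S + (S′ + g m * h l)) (n∸n≡0 m) ⟩
    S + (S′ + g m * h 0)                               ≡⟨ regroup S S′ (g m) (h 0) ⟩
    (S + S′) + g m * (0 + h 0)                         ≡⟨ cong₂ _+_ (sym (trans (sum<-cong m λ k k<m → extend k (<⇒≤ k<m)) (sum<-distrib-+ m _ _)))
                                                                  (cong (λ l → g m * H l) (sym (trans (+-∸-assoc 1 (≤-refl {m})) (cong suc (n∸n≡0 m))))) ⟩
    sum< m (λ k → g k * H (suc m ∸ k)) + g m * H (suc m ∸ m) ∎
    where
    open ≡-Reasoning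
    S  = sum< m (λ k → g k * H (m ∸ k))
    S′ = sum< m (λ k → g k * h (m ∸ k))
    regroup : ∀ s s′ x y → s + (s′ + x * y) ≡ (s + s′) + x * (0 + y)
    regroup = solve-∀
    extend : ∀ k → k ≤ m → g k * H (suc m ∸ k) ≡ g k * H (m ∸ k) + g k * h (m ∸ k)
    extend k k≤m = trans (cong (λ l → g k * H l) (+-∸-assoc 1 k≤m)) (*-distribˡ-+ (g k) (H (m ∸ k)) (h (m ∸ k)))

expNum-submultiplicative : ∀ a b n → n ! * expNum (a + b) n ≤ expNum a n * expNum b n
expNum-submultiplicative a b n = begin
  n ! * expNum (a + b) n                              ≡⟨ cong (n ! *_) (expNum-as-sum (a + b) n) ⟩
  n ! * sum< (suc n) (λ j → (a + b) ^ j * ratio n j) ≡⟨ sym (*-distribˡ-sum< (suc n) (n !) _) ⟩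
  sum< (suc n) (λ j → n ! * ((a + b) ^ j * ratio n j)) ≡⟨ sum<-cong (suc n) (λ j j≤n → binomial j (≤-pred j≤n)) ⟩
  sum< (suc n) convolution                            ≡⟨ sum-convolution (suc n) ⟩
  sum< (suc n) (λ k → g k * H (suc n ∸ k))            ≤⟨ sum<-mono-≤ (suc n) (λ k _ → *-monoʳ-≤ (g k) (H-mono (m∸n≤m (suc n) k))) ⟩
  sum< (suc n) (λ k → g k * H (suc n))                ≡⟨ trans (sum<-cong (suc n) (λ k _ → *-comm (g k) _)) (*-distribˡ-sum< (suc n) (H (suc n)) g) ⟩
  H (suc n) * sum< (suc n) g                          ≡⟨ *-comm (H (suc n)) _ ⟩
  sum< (suc n) g * H (suc n)                          ≡⟨ sym (cong₂ _*_ (expNum-as-sum a n) (expNum-as-sum b n)) ⟩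
  expNum a n * expNum b n                             ∎
  where
  open ≤-Reasoning
  open CauchyProduct a b n

expNum-zero : ∀ n → expNum 0 n ≡ n !
expNum-zero zero    = refl
expNum-zero (suc n) = trans (+-identityʳ _) (cong (suc n *_) (expNum-zero n))

expNum-one : ∀ n → expNum 1 n + 2 ≤ 4 * n !
expNum-one zero          = s≤s (s≤s (s≤s z≤n))
expNum-one (suc zero)    = ≤-refl
expNum-one (suc (suc m)) = begin
  k * expNum 1 (suc m) + 1 ^ k + 2 ≡⟨ cong (λ o → k * expNum 1 (suc m) + o + 2) (^-zeroˡ k) ⟩
  k * expNum 1 (suc m) + 1 + 2     ≤⟨ absorb (expNum 1 (suc m)) m ⟩
  k * (expNum 1 (suc m) + 2)       ≤⟨ *-monoʳ-≤ k (expNum-one (suc m)) ⟩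
  k * (4 * suc m !)                ≡⟨ x∙yz≈y∙xz k 4 (suc m !) ⟩
  4 * (k * suc m !)                ∎
  where
  open ≤-Reasoning
  k = suc (suc m)
  absorb : ∀ e m → suc (suc m) * e + 1 + 2 ≤ suc (suc m) * (e + 2)
  absorb e m = ≤-trans (m≤m+n _ (1 + 2 * m)) (≤-reflexive (expand e m))
    where
    expand : ∀ e m → suc (suc m) * e + 1 + 2 + (1 + 2 * m) ≡ suc (suc m) * (e + 2)
    expand = solve-∀

expNum≤4^t*n! : ∀ t n → expNum t n ≤ 4 ^ t * n !
expNum≤4^t*n! zero    n = ≤-reflexive (trans (expNum-zero n) (sym (+-identityʳ _)))
expNum≤4^t*n! (suc t) n = *-cancelʳ-≤-pos _ _ (n !) (1≤n! n) (begin
  expNum (suc t) n * n !        ≡⟨ *-comm _ (n !) ⟩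
  n ! * expNum (suc t) n        ≤⟨ subst (λ s → n ! * expNum s n ≤ expNum t n * expNum 1 n) (+-comm t 1) (expNum-submultiplicative t 1 n) ⟩
  expNum t n * expNum 1 n       ≤⟨ *-mono-≤ (expNum≤4^t*n! t n) (≤-trans (m≤m+n _ 2) (expNum-one n)) ⟩
  4 ^ t * n ! * (4 * n !)       ≡⟨ regroup (4 ^ t) (n !) ⟩
  4 * 4 ^ t * n ! * n !         ∎)
  where
  open ≤-Reasoning
  regroup : ∀ p f → p * f * (4 * f) ≡ 4 * p * f * f
  regroup = solve-∀

*-distribʳ-^ : ∀ x y k → (x * y) ^ k ≡ x ^ k * y ^ k
*-distribʳ-^ x y zero    = refl
*-distribʳ-^ x y (suc k) = trans (cong ((x * y) *_) (*-distribʳ-^ x y k)) ([m*n]*[o*p]≡[m*o]*[n*p] x y (x ^ k) (y ^ k))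

x^n≤expNum : ∀ x n → x ^ n ≤ expNum x n
x^n≤expNum x zero    = ≤-refl
x^n≤expNum x (suc n) = m≤n+m _ _

expNum-top-terms : ∀ x m → x ^ suc m * (suc (suc m) + x) ≤ expNum x (suc (suc m))
expNum-top-terms x m = begin
  x ^ suc m * (suc (suc m) + x)                          ≡⟨ *-distribˡ-+ (x ^ suc m) (suc (suc m)) x ⟩
  x ^ suc m * suc (suc m) + x ^ suc m * x                ≡⟨ cong₂ _+_ (*-comm (x ^ suc m) _) (*-comm (x ^ suc m) x) ⟩
  suc (suc m) * x ^ suc m + x ^ suc (suc m)              ≤⟨ +-monoˡ-≤ _ (*-monoʳ-≤ (suc (suc m)) (x^n≤expNum x (suc m))) ⟩
  suc (suc m) * expNum x (suc m) + x ^ suc (suc m)       ∎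
  where open ≤-Reasoning

2^r*[1+r]^[1+r]≤[2r+1]^[1+r] : ∀ r → 2 ^ r * suc r ^ suc r ≤ (2 * r + 1) ^ suc r
2^r*[1+r]^[1+r]≤[2r+1]^[1+r] r = +-cancelʳ-≤ Z _ _ (begin
  2 ^ r * suc r ^ suc r + Z                         ≡⟨ cong (_+ Z) Z-closed ⟩
  Z + Z                                             ≡⟨ doubled ⟩
  suc (2 * r + 1) ^ suc r                           ≤⟨ suc-^-upperBound (2 * r + 1) r ⟩
  (2 * r + 1) ^ suc r + Z                           ∎)
  where
  open ≤-Reasoning
  suc[2r+1]≡2[1+r] : ∀ r → suc (2 * r + 1) ≡ 2 * suc r
  suc[2r+1]≡2[1+r] = solve-∀
  Z = suc r * suc (2 * r + 1) ^ r
  Z-closed : 2 ^ r * suc r ^ suc r ≡ Z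
  Z-closed = begin-equality
    2 ^ r * (suc r * suc r ^ r)   ≡⟨ x∙yz≈y∙xz (2 ^ r) (suc r) (suc r ^ r) ⟩
    suc r * (2 ^ r * suc r ^ r)   ≡⟨ cong (suc r *_) (sym (trans (cong (_^ r) (suc[2r+1]≡2[1+r] r)) (*-distribʳ-^ 2 (suc r) r))) ⟩
    Z                             ∎
  doubled : Z + Z ≡ suc (2 * r + 1) ^ suc r
  doubled = begin-equality
    Z + Z                                        ≡⟨ cong (Z +_) (sym (+-identityʳ Z)) ⟩
    2 * Z                                        ≡⟨ sym (*-assoc 2 (suc r) _) ⟩
    2 * suc r * suc (2 * r + 1) ^ r              ≡⟨ cong (_* suc (2 * r + 1) ^ r) (sym (suc[2r+1]≡2[1+r] r)) ⟩
    suc (2 * r + 1) * suc (2 * r + 1) ^ r        ∎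

4*[2+r]≤2^r*[3+3r] : ∀ r → 1 ≤ r → 4 * (2 + r) ≤ 2 ^ r * (3 * (1 + r))
4*[2+r]≤2^r*[3+3r] (suc r) _ = begin
  4 * (3 + r)                  ≤⟨ m≤m+n _ (2 * r) ⟩
  4 * (3 + r) + 2 * r          ≡⟨ expand r ⟩
  2 * (3 * (2 + r))            ≤⟨ *-monoˡ-≤ (3 * (2 + r)) (*-monoʳ-≤ 2 (^-pos 2 r (s≤s z≤n))) ⟩
  2 * 2 ^ r * (3 * (2 + r))    ∎
  where
  open ≤-Reasoning
  expand : ∀ r → 4 * (3 + r) + 2 * r ≡ 2 * (3 * (2 + r))
  expand = solve-∀

-- Only the terms of degree r+1 and r+2 of the series at n = r+2 are needed.
4*d^[1+r]≤ℓ^r*[1+r]! : ∀ d ℓ r → 1 ≤ r →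
  d ^ suc r * expNum (2 * r + 1) (suc (suc r)) ≤ ℓ ^ r * suc r ^ suc r * suc (suc r) ! →
  4 * d ^ suc r ≤ ℓ ^ r * suc r !
4*d^[1+r]≤ℓ^r*[1+r]! d ℓ r r≥1 threshold = *-cancelʳ-≤-pos _ _ (2 + r) (s≤s z≤n) (begin
  4 * Y * (2 + r)                   ≡⟨ *-assoc 4 Y (2 + r) ⟩
  4 * (Y * (2 + r))                 ≡⟨ x∙yz≈y∙xz 4 Y (2 + r) ⟩
  Y * (4 * (2 + r))                 ≤⟨ *-monoʳ-≤ Y (4*[2+r]≤2^r*[3+3r] r r≥1) ⟩
  Y * (2 ^ r * (3 * (1 + r)))       ≤⟨ *-cancelʳ-≤-pos _ _ P (^-pos (suc r) (suc r) (s≤s z≤n)) scaled ⟩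
  ℓ ^ r * suc r ! * (2 + r)         ∎)
  where
  open ≤-Reasoning
  Y = d ^ suc r
  P = suc r ^ suc r
  x = 2 * r + 1
  scaled : Y * (2 ^ r * (3 * (1 + r))) * P ≤ ℓ ^ r * suc r ! * (2 + r) * P
  scaled = begin
    Y * (2 ^ r * (3 * (1 + r))) * P ≡⟨ regroup Y (2 ^ r) P r ⟩
    Y * (2 ^ r * P * (2 + r + x))   ≤⟨ *-monoʳ-≤ Y (*-monoˡ-≤ _ (2^r*[1+r]^[1+r]≤[2r+1]^[1+r] r)) ⟩
    Y * (x ^ suc r * (2 + r + x))   ≤⟨ *-monoʳ-≤ Y (expNum-top-terms x r) ⟩
    Y * expNum x (2 + r)            ≤⟨ threshold ⟩
    ℓ ^ r * P * (2 + r) !           ≡⟨ reorder (ℓ ^ r) P (2 + r) (suc r !) ⟩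
    ℓ ^ r * suc r ! * (2 + r) * P   ∎
    where
    regroup : ∀ Y q P r → Y * (q * (3 * (1 + r))) * P ≡ Y * (q * P * (2 + r + (2 * r + 1)))
    regroup = solve-∀
    reorder : ∀ L P s f → L * P * (s * f) ≡ L * f * s * P
    reorder = solve-∀

4*[dΔ⊔1]≤4^t : ∀ d Δ t → 1 ≤ t → (∃[ n ] 4 * d * Δ * n ! ≤ expNum t n) → 4 * (d * Δ ⊔ 1) ≤ 4 ^ t
4*[dΔ⊔1]≤4^t d Δ t t≥1 (n , threshold) = begin
  4 * (d * Δ ⊔ 1)      ≡⟨ *-distribˡ-⊔ 4 (d * Δ) 1 ⟩
  4 * (d * Δ) ⊔ 4      ≤⟨ ⊔-lub 4dΔ≤4^t (^-monoʳ-≤ 4 t≥1) ⟩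
  4 ^ t                ∎
  where
  open ≤-Reasoning
  4dΔ≤4^t : 4 * (d * Δ) ≤ 4 ^ t
  4dΔ≤4^t = *-cancelʳ-≤-pos _ _ (n !) (1≤n! n)
    (≤-trans (≤-reflexive (cong (_* n !) (sym (*-assoc 4 d Δ)))) (≤-trans threshold (expNum≤4^t*n! t n)))

-- The t colourings B → [ℓ] are encoded as one outcome in [ℓ]^(t·b), colouring i using the block
-- of coordinates combine i w.
module RandomColourings (ℓ t b a : ℕ) (E : Fin a → Fin b → Bool) (r : ℕ) where

  open Outcomes ℓ
  open ColourHits ℓ

  n : ℕ
  n = t * b

  block : Fin n → Fin t
  block j = proj₁ (remQuot {t} b j)

  vertex : Fin n → Fin b
  vertex j = proj₂ (remQuot {t} b j)

  block-combine : ∀ i w → block (combine i w) ≡ i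
  block-combine i w = cong proj₁ (remQuot-combine {t} {b} i w)

  vertex-combine : ∀ i w → vertex (combine i w) ≡ w
  vertex-combine i w = cong proj₂ (remQuot-combine {t} {b} i w)

  colourings : Ω n → Fin t → Fin b → Fin ℓ
  colourings f i w = f (combine i w)

  count-in-block : (P : Fin n → Bool) (R : Fin b → Bool) (i : Fin t) →
    (∀ i′ w → P (combine i′ w) ≡ (i′ == i ∧ R w)) → count P ≡ count R
  count-in-block P R i P-in-block = begin
    count P                                                     ≡⟨ count≡sum P ⟩
    ∑[ j < t * b ] b2n (P j)                                     ≡⟨ sum-combine t b _ ⟩
    ∑[ i′ < t ] ∑[ w < b ] b2n (P (combine i′ w))                ≡⟨ sum-cong-≗ (λ i′ → sum-cong-≗ λ w → cong b2n (P-in-block i′ w)) ⟩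
    ∑[ i′ < t ] ∑[ w < b ] b2n (i′ == i ∧ R w)                   ≡⟨ sum-supported-at _ i other-blocks ⟩
    ∑[ w < b ] b2n (i == i ∧ R w)                                ≡⟨ sum-cong-≗ (λ w → cong (λ x → b2n (x ∧ R w)) (==-refl i)) ⟩
    ∑[ w < b ] b2n (R w)                                         ≡⟨ sym (count≡sum R) ⟩
    count R                                                     ∎
    where
    open ≡-Reasoning
    other-blocks : ∀ i′ → i′ ≢ i → ∑[ w < b ] b2n (i′ == i ∧ R w) ≡ 0
    other-blocks i′ i′≢i with i′ == i in i′==i
    ... | true  = ⊥-elim (i′≢i (==⇒≡ i′ i i′==i))
    ... | false = trans (sum-const b 0) (*-zeroʳ b)

  mask : Fin a → Fin t → Fin n → Bool
  mask v i j = block j == i ∧ E v (vertex j)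

  neighbourhood : Fin a → Fin n → Bool
  neighbourhood v j = E v (vertex j)

  count-mask : ∀ v i → count (mask v i) ≡ degA E v
  count-mask v i = count-in-block _ _ i λ i′ w → cong₂ (λ x y → x == i ∧ E v y) (block-combine i′ w) (vertex-combine i′ w)

  hits≡colourCount : ∀ v i k f → hits (mask v i) k f ≡ colourCount E (colourings f i) v k
  hits≡colourCount v i k f = count-in-block _ _ i in-block
    where
    in-block : ∀ i′ w → (block (combine i′ w) == i ∧ E v (vertex (combine i′ w))) ∧ (f (combine i′ w) == k)
                        ≡ (i′ == i ∧ (E v w ∧ (f (combine i w) == k)))
    in-block i′ w rewrite block-combine i′ w | vertex-combine i′ w with i′ == i in i′==i
    ... | false = refl
    ... | true rewrite ==⇒≡ i′ i i′==i = refl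

  overloaded : Fin a → Fin t → Fin ℓ → Ω n → Bool
  overloaded v i k f = atLeast (suc r) (hits (mask v i) k f)

  improper : Fin a → Fin t → Ω n → Bool
  improper v i f = anyᵇ (λ k → overloaded v i k f)

  bad : Fin a → Ω n → Bool
  bad v f = allᵇ (λ i → improper v i f)

  hits-determinedBy : ∀ (M : Fin n → Bool) k (f g : Ω n) → (∀ j → M j ≡ true → f j ≡ g j) → hits M k f ≡ hits M k g
  hits-determinedBy M k f g f≈g = count-cong agree
    where
    agree : ∀ j → (M j ∧ (f j == k)) ≡ (M j ∧ (g j == k))
    agree j with M j in Mj
    ... | false = refl
    ... | true  = cong (_== k) (f≈g j Mj)

  improper-determinedBy : ∀ v i → DeterminedBy (mask v i) (improper v i)
  improper-determinedBy v i f g f≈g = anyᵇ-cong λ k → cong (atLeast (suc r)) (hits-determinedBy (mask v i) k f g f≈g)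

  bad-determinedBy : ∀ v → DeterminedBy (neighbourhood v) (bad v)
  bad-determinedBy v f g f≈g = allᵇ-cong λ i → improper-determinedBy v i f g λ j mask-j → f≈g j (proj₂ (∧-true mask-j))

  card-improper≤ : 0 < ℓ → ∀ d v i → degA E v ≤ d → card n (improper v i) * (ℓ ^ r * suc r !) ≤ d ^ suc r * ℓ ^ n
  card-improper≤ ℓ>0 d v i deg≤d = *-cancelʳ-≤-pos _ _ ℓ ℓ>0 (subst₂ _≤_ (*-comm ℓ _) (*-comm ℓ _) (begin
    ℓ * (card n (improper v i) * Q)                   ≡⟨ x∙yz≈y∙xz ℓ (card n (improper v i)) Q ⟩
    card n (improper v i) * (ℓ * Q)                   ≤⟨ *-monoˡ-≤ (ℓ * Q) (card-any≤sum n ℓ (overloaded v i)) ⟩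
    ∑[ k < ℓ ] card n (overloaded v i k) * (ℓ * Q)    ≡⟨ *-distribʳ-sum {ℓ} (ℓ * Q) _ ⟩
    ∑[ k < ℓ ] (card n (overloaded v i k) * (ℓ * Q))  ≤⟨ sum-mono-≤ per-colour ⟩
    ∑[ k < ℓ ] (d ^ suc r * ℓ ^ n)                    ≡⟨ sum-const ℓ _ ⟩
    ℓ * (d ^ suc r * ℓ ^ n)                           ∎))
    where
    open ≤-Reasoning
    Q = ℓ ^ r * suc r !
    per-colour : ∀ k → card n (overloaded v i k) * (ℓ * Q) ≤ d ^ suc r * ℓ ^ n
    per-colour k = begin
      card n (overloaded v i k) * (ℓ * Q)              ≡⟨ cong (card n (overloaded v i k) *_) (sym (*-assoc ℓ (ℓ ^ r) (suc r !))) ⟩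
      card n (overloaded v i k) * (ℓ ^ suc r * suc r !) ≤⟨ card-hits≥ n (mask v i) k (suc r) ⟩
      count (mask v i) ^ suc r * ℓ ^ n                 ≤⟨ *-monoˡ-≤ (ℓ ^ n) (^-monoˡ-≤ (suc r) (≤-trans (≤-reflexive (count-mask v i)) deg≤d)) ⟩
      d ^ suc r * ℓ ^ n                                ∎

  -- The t colourings use disjoint blocks of coordinates, so the bad events multiply.
  card-bad≤ : 0 < ℓ → ∀ d v → degA E v ≤ d → card n (bad v) * (ℓ ^ r * suc r !) ^ t ≤ (d ^ suc r) ^ t * ℓ ^ n
  card-bad≤ ℓ>0 d v deg≤d = card-all-≤ ℓ>0 n t (improper v) (mask v) (improper-determinedBy v) same-block
    (ℓ ^ r * suc r !) (d ^ suc r) (λ i → card-improper≤ ℓ>0 d v i deg≤d)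
    where
    same-block : ∀ i i′ j → mask v i j ≡ true → mask v i′ j ≡ true → i ≡ i′
    same-block i i′ j in-i in-i′ =
      trans (sym (==⇒≡ (block j) i (proj₁ (∧-true in-i)))) (==⇒≡ (block j) i′ (proj₁ (∧-true in-i′)))

  share-neighbour : Fin a → Fin a → Bool
  share-neighbour v u = anyᵇ (λ w → E v w ∧ E u w)

  share-neighbour-disjoint : ∀ v u → share-neighbour v u ≡ false → Disjoint (neighbourhood v) (neighbourhood u)
  share-neighbour-disjoint v u none j Evj Euj with trans (sym (anyᵇ-false _ none (vertex j))) (cong₂ _∧_ Evj Euj)
  ... | ()

  count-share-neighbour≤ : ∀ d Δ → (∀ v → degA E v ≤ d) → (∀ w → degB E w ≤ Δ) → ∀ v → count (share-neighbour v) ≤ d * Δ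
  count-share-neighbour≤ d Δ degA≤d degB≤Δ v = begin
    count (share-neighbour v)                              ≡⟨ count≡sum (share-neighbour v) ⟩
    ∑[ u < a ] b2n (share-neighbour v u)                   ≤⟨ sum-mono-≤ (λ u → b2n-anyᵇ≤sum (λ w → E v w ∧ E u w)) ⟩
    ∑[ u < a ] ∑[ w < b ] b2n (E v w ∧ E u w)              ≡⟨ ∑-comm {a} {b} _ ⟩
    ∑[ w < b ] ∑[ u < a ] b2n (E v w ∧ E u w)              ≡⟨ sum-cong-≗ (λ w → trans (sum-cong-≗ λ u → b2n-∧ (E v w) (E u w))
                                                                                      (sym (*-distribˡ-sum {a} (b2n (E v w)) _))) ⟩
    ∑[ w < b ] (b2n (E v w) * ∑[ u < a ] b2n (E u w))     ≤⟨ sum-mono-≤ (λ w → *-monoʳ-≤ (b2n (E v w))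
                                                               (≤-trans (≤-reflexive (sym (count≡sum (λ u → E u w)))) (degB≤Δ w))) ⟩
    ∑[ w < b ] (b2n (E v w) * Δ)                           ≡⟨ sym (*-distribʳ-sum {b} Δ _) ⟩
    ∑[ w < b ] b2n (E v w) * Δ                             ≡⟨ cong (_* Δ) (sym (count≡sum (E v))) ⟩
    degA E v * Δ                                           ≤⟨ *-monoˡ-≤ Δ (degA≤d v) ⟩
    d * Δ                                                  ∎
    where open ≤-Reasoning

  proper-somewhere : ∀ v f → bad v f ≡ false → ∃[ i ] ∀ k → colourCount E (colourings f i) v k ≤ r
  proper-somewhere v f not-bad with allᵇ-false _ not-bad
  ... | i , proper = i , λ k → subst (_≤ r) (hits≡colourCount v i k f)
    (≤-pred (atLeast-false (suc r) (hits (mask v i) k f) (anyᵇ-false _ proper k)))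

[d^[1+r]]^t*4[dΔ⊔1]≤[ℓ^r*[1+r]!]^t : ∀ d Δ r t ℓ → 1 ≤ r → 1 ≤ t →
  (∀ n → d ^ suc r * expNum (2 * r + 1) n ≤ ℓ ^ r * suc r ^ suc r * n !) →
  (∃[ n ] 4 * d * Δ * n ! ≤ expNum t n) →
  (d ^ suc r) ^ t * (4 * (d * Δ ⊔ 1)) ≤ (ℓ ^ r * suc r !) ^ t
[d^[1+r]]^t*4[dΔ⊔1]≤[ℓ^r*[1+r]!]^t d Δ r t ℓ r≥1 t≥1 threshold-ℓ threshold-t = begin
  (d ^ suc r) ^ t * (4 * (d * Δ ⊔ 1)) ≤⟨ *-monoʳ-≤ ((d ^ suc r) ^ t) (4*[dΔ⊔1]≤4^t d Δ t t≥1 threshold-t) ⟩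
  (d ^ suc r) ^ t * 4 ^ t             ≡⟨ sym (*-distribʳ-^ (d ^ suc r) 4 t) ⟩
  (d ^ suc r * 4) ^ t                 ≤⟨ ^-monoˡ-≤ t (≤-trans (≤-reflexive (*-comm (d ^ suc r) 4))
                                           (4*d^[1+r]≤ℓ^r*[1+r]! d ℓ r r≥1 (threshold-ℓ (suc (suc r))))) ⟩
  (ℓ ^ r * suc r !) ^ t               ∎
  where open ≤-Reasoning

scaled-bound : ∀ c L X Y e → 0 < X → c * X ≤ Y * L → Y * e ≤ X → c * e ≤ L
scaled-bound c L X Y e X>0 cX≤YL Ye≤X = *-cancelʳ-≤-pos _ _ X X>0 (begin
  c * e * X ≡⟨ xy∙z≈xz∙y c e X ⟩
  c * X * e ≤⟨ *-monoˡ-≤ e cX≤YL ⟩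
  Y * L * e ≡⟨ xy∙z≈xz∙y Y L e ⟩
  Y * e * L ≤⟨ *-monoˡ-≤ L Ye≤X ⟩
  X * L     ≡⟨ *-comm X L ⟩
  L * X     ∎)
  where open ≤-Reasoning

lemma3p3 : (a b d Δ r t ℓ : ℕ) (E : Fin a → Fin b → Bool) →
    (∀ v → degA E v ≤ d) → (∀ w → degB E w ≤ Δ) →
    1 ≤ r → 1 ≤ t → 1 ≤ ℓ →
    (∀ n → d ^ suc r * expNum (2 * r + 1) n ≤ ℓ ^ r * suc r ^ suc r * n !) →
    (∃[ n ] 4 * d * Δ * n ! ≤ expNum t n) →
    Σ (Fin t → Fin b → Fin ℓ) λ c →
      ∀ v → ∃[ i ] ∀ (k : Fin ℓ) → colourCount E (c i) v k ≤ r
lemma3p3 a b d Δ r t ℓ E degA≤d degB≤Δ r≥1 t≥1 ℓ≥1 threshold-ℓ threshold-t =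
  colourings f , λ v → proper-somewhere v f (f-avoids v)
  where
  open Outcomes ℓ
  open RandomColourings ℓ t b a E r
  D = d * Δ ⊔ 1
  X = ℓ ^ r * suc r !
  card-bad*4D≤ : ∀ v → card n (bad v) * (4 * D) ≤ ℓ ^ n
  card-bad*4D≤ v = scaled-bound (card n (bad v)) (ℓ ^ n) (X ^ t) ((d ^ suc r) ^ t) (4 * D)
    (^-pos X t (*-mono-≤ (^-pos ℓ r ℓ≥1) (1≤n! (suc r))))
    (card-bad≤ ℓ≥1 d v (degA≤d v))
    ([d^[1+r]]^t*4[dΔ⊔1]≤[ℓ^r*[1+r]!]^t d Δ r t ℓ r≥1 t≥1 threshold-ℓ threshold-t)
  open LocalLemma ℓ ℓ≥1 n a bad neighbourhood bad-determinedBy share-neighbour share-neighbour-disjoint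
    D (m≤n⊔m (d * Δ) 1) (λ v → ≤-trans (count-share-neighbour≤ d Δ degA≤d degB≤Δ v) (m≤m⊔n (d * Δ) 1))
    card-bad*4D≤ using (avoid-all)
  f = proj₁ avoid-all
  f-avoids = proj₂ avoid-all
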